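{- Let $F$ be a non-empty finite collection of finite sets. If $|\bigcap \Gamma_1-\bigcup \Gamma_2|=|\bigcap \Gamma_2-\bigcup \Gamma_1|$ holds for every two non-empty disjoint subcollections $\Gamma_1,\Gamma_2$ of $F$ with $\Gamma_1\cup\Gamma_2=F$, then all members of $F$ have the same cardinality.
   Context: $X-Y$ denotes set difference. -}

module Defs where

open import Data.Nat using (ℕ)
open import Data.Fin using (Fin)
open import Data.List using (List; map; filter; allFin)
open import Data.Fin.Subset using (Subset; ⋂; ⋃; _∈_)
open import Data.Fin.Subset.Properties using (_∈?_)

-- A finite collection of finite sets: a family F : Fin m → Subset n
-- (sets over a common finite ground set Fin n).  A subcollection Γ is
-- a subset of the index set Fin m.

members : ∀ {m n} → (Fin m → Subset n) → Subset m → List (Subset n)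
members F Γ = map F (filter (_∈? Γ) (allFin _))

⋂[_]_ : ∀ {m n} → (Fin m → Subset n) → Subset m → Subset n
⋂[ F ] Γ = ⋂ (members F Γ)

⋃[_]_ : ∀ {m n} → (Fin m → Subset n) → Subset m → Subset n
⋃[ F ] Γ = ⋃ (members F Γ)

-- Sort the points of the ground set by their profile, the set of indices i with x ∈ F i.
-- The points with profile exactly Γ form the Venn region R Γ = ⋂ Γ ─ ⋃ (F ─ Γ), so
-- |F i| = Σ_{Γ ∋ i} |R Γ| and hence |F i| − |F j| = Σ_{i ∈ Γ ∌ j} |R Γ| − Σ_{j ∈ Γ ∌ i} |R Γ|.
-- Complementation Γ ↦ F ─ Γ exchanges the index sets of these two sums, and the hypothesis
-- says exactly that it preserves |R Γ| whenever Γ and F ─ Γ are both non-empty.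
module Submission where

open import Defs
open import Data.Bool using (Bool; true; false; _∧_; _∨_; not)
import Data.Bool as Bool
open import Data.Bool.Properties using (∧-comm; ∧-zeroʳ; not-involutive)
open import Data.Fin using (Fin; zero; suc)
open import Data.Fin.Subset using (Subset; Nonempty; Empty; _∩_; _∪_; _─_; ∣_∣; ⊤; ⋂; ⋃; ∁; _∈_)
open import Data.Fin.Subset.Properties using (_∈?_; p∪∁p≡⊤; ∩-inverseʳ; ∉⊥)
open import Data.List using (List; filter; allFin)
open import Data.Bool.ListAction using (and; or; all; any)
import Data.List as List
import Data.List.Properties as List
open import Data.Nat using (ℕ; NonZero; _+_; _*_)
open import Data.Nat.Properties using (+-identityʳ; *-zeroʳ; *-comm; *-distribˡ-+; +-comm; +-commutativeSemigroup)
open import Algebra.Properties.CommutativeSemigroup +-commutativeSemigroup using (interchange)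
open import Data.Product using (_,_)
open import Data.Vec using ([]; _∷_; lookup; tabulate)
open import Data.Vec.Properties using (≡-dec; lookup-map; lookup-zipWith; lookup-replicate; lookup⇒[]=; lookup∘tabulate; tabulate∘lookup; tabulate-cong; map-∘; map-cong; map-id)
open import Function using (_∘_)
open import Function.Definitions using (Injective)
open import Relation.Nullary using (Dec; does)
open import Relation.Binary.PropositionalEquality using (_≡_; refl; sym; trans; cong; cong₂; subst; module ≡-Reasoning)

open ≡-Reasoning

𝟙 : Bool → ℕ
𝟙 true  = 1
𝟙 false = 0

_≟_ : ∀ {m} (p q : Subset m) → Dec (p ≡ q)
_≟_ = ≡-dec Bool._≟_

∣x∷p∣≡𝟙x+∣p∣ : ∀ {n} x (p : Subset n) → ∣ x ∷ p ∣ ≡ 𝟙 x + ∣ p ∣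
∣x∷p∣≡𝟙x+∣p∣ true  p = refl
∣x∷p∣≡𝟙x+∣p∣ false p = refl

∁-involutive : ∀ {m} (p : Subset m) → ∁ (∁ p) ≡ p
∁-involutive p = trans (sym (map-∘ not not p)) (trans (map-cong not-involutive p) (map-id p))

∁-disjoint : ∀ {m} (p : Subset m) → Empty (p ∩ ∁ p)
∁-disjoint p (x , x∈p∩∁p) = ∉⊥ (subst (x ∈_) (∩-inverseʳ p) x∈p∩∁p)

∑ˢ : ∀ {m} → (Subset m → ℕ) → ℕ
∑ˢ {ℕ.zero} f = f []
∑ˢ {ℕ.suc m} f = ∑ˢ (f ∘ (true ∷_)) + ∑ˢ (f ∘ (false ∷_))

∑ˢ-cong : ∀ {m} {f g : Subset m → ℕ} → (∀ Γ → f Γ ≡ g Γ) → ∑ˢ f ≡ ∑ˢ g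
∑ˢ-cong {ℕ.zero}  f≗g = f≗g []
∑ˢ-cong {ℕ.suc m} f≗g = cong₂ _+_ (∑ˢ-cong (f≗g ∘ (true ∷_))) (∑ˢ-cong (f≗g ∘ (false ∷_)))

∑ˢ-zero : ∀ {m} → ∑ˢ {m} (λ _ → 0) ≡ 0
∑ˢ-zero {ℕ.zero}  = refl
∑ˢ-zero {ℕ.suc m} = cong₂ _+_ (∑ˢ-zero {m}) (∑ˢ-zero {m})

∑ˢ-+ : ∀ {m} (f g : Subset m → ℕ) → ∑ˢ (λ Γ → f Γ + g Γ) ≡ ∑ˢ f + ∑ˢ g
∑ˢ-+ {ℕ.zero}  f g = refl
∑ˢ-+ {ℕ.suc m} f g = trans
  (cong₂ _+_ (∑ˢ-+ (f ∘ (true ∷_)) (g ∘ (true ∷_))) (∑ˢ-+ (f ∘ (false ∷_)) (g ∘ (false ∷_))))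
  (interchange (∑ˢ (f ∘ (true ∷_))) (∑ˢ (g ∘ (true ∷_))) (∑ˢ (f ∘ (false ∷_))) (∑ˢ (g ∘ (false ∷_))))

∑ˢ-∁ : ∀ {m} (f : Subset m → ℕ) → ∑ˢ (f ∘ ∁) ≡ ∑ˢ f
∑ˢ-∁ {ℕ.zero}  f = refl
∑ˢ-∁ {ℕ.suc m} f = trans
  (cong₂ _+_ (∑ˢ-∁ (f ∘ (false ∷_))) (∑ˢ-∁ (f ∘ (true ∷_))))
  (+-comm (∑ˢ (f ∘ (false ∷_))) (∑ˢ (f ∘ (true ∷_))))

∑ˢ-point : ∀ {m} (p : Subset m) (f : Subset m → ℕ) → ∑ˢ (λ Γ → 𝟙 (does (p ≟ Γ)) * f Γ) ≡ f p
∑ˢ-point             []          f = +-identityʳ (f [])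
∑ˢ-point {ℕ.suc m} (true ∷ p)  f = trans (cong₂ _+_ (∑ˢ-point p (f ∘ (true ∷_))) (∑ˢ-zero {m})) (+-identityʳ _)
∑ˢ-point {ℕ.suc m} (false ∷ p) f = cong₂ _+_ (∑ˢ-zero {m}) (∑ˢ-point p (f ∘ (false ∷_)))

∑ˢ-split : ∀ {m} (a b : Subset m → Bool) (f : Subset m → ℕ) →
  ∑ˢ (λ Γ → 𝟙 (a Γ) * f Γ) ≡ ∑ˢ (λ Γ → 𝟙 (a Γ ∧ b Γ) * f Γ) + ∑ˢ (λ Γ → 𝟙 (a Γ ∧ not (b Γ)) * f Γ)
∑ˢ-split a b f = trans (∑ˢ-cong (λ Γ → 𝟙-split (a Γ) (b Γ) (f Γ)))
  (∑ˢ-+ (λ Γ → 𝟙 (a Γ ∧ b Γ) * f Γ) (λ Γ → 𝟙 (a Γ ∧ not (b Γ)) * f Γ))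
  where
  𝟙-split : ∀ x y k → 𝟙 x * k ≡ 𝟙 (x ∧ y) * k + 𝟙 (x ∧ not y) * k
  𝟙-split true  true  k = sym (+-identityʳ _)
  𝟙-split true  false k = refl
  𝟙-split false y     k = refl

∑ˢ-separating-swap : ∀ {m} (f : Subset m → ℕ) →
  (∀ Γ → Nonempty Γ → Nonempty (∁ Γ) → f Γ ≡ f (∁ Γ)) → ∀ i j →
  ∑ˢ (λ Γ → 𝟙 (lookup Γ i ∧ not (lookup Γ j)) * f Γ) ≡ ∑ˢ (λ Γ → 𝟙 (lookup Γ j ∧ not (lookup Γ i)) * f Γ)
∑ˢ-separating-swap f f∘∁≗f i j =
  trans (sym (∑ˢ-∁ (λ Γ → 𝟙 (lookup Γ i ∧ not (lookup Γ j)) * f Γ))) (∑ˢ-cong swap)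
  where
  swap : ∀ Γ → 𝟙 (lookup (∁ Γ) i ∧ not (lookup (∁ Γ) j)) * f (∁ Γ) ≡ 𝟙 (lookup Γ j ∧ not (lookup Γ i)) * f Γ
  swap Γ rewrite lookup-map i not Γ | lookup-map j not Γ with lookup Γ i in Γi | lookup Γ j in Γj
  ... | true  | true  = refl
  ... | true  | false = refl
  ... | false | false = refl
  ... | false | true  = cong (_+ 0) (sym (f∘∁≗f Γ (j , lookup⇒[]= j Γ Γj) (i , lookup⇒[]= i (∁ Γ) (trans (lookup-map i not Γ) (cong not Γi)))))

∣tabulate∣-by-profile : ∀ {m n} (g : Fin n → Subset m) (φ : Subset m → Bool) →
  ∣ tabulate (φ ∘ g) ∣ ≡ ∑ˢ (λ Γ → 𝟙 (φ Γ) * ∣ tabulate (λ x → does (g x ≟ Γ)) ∣)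
∣tabulate∣-by-profile {m} {ℕ.zero} g φ = sym (trans (∑ˢ-cong (λ Γ → *-zeroʳ (𝟙 (φ Γ)))) (∑ˢ-zero {m}))
∣tabulate∣-by-profile {m} {ℕ.suc n} g φ = begin
  ∣ tabulate (φ ∘ g) ∣
    ≡⟨ ∣x∷p∣≡𝟙x+∣p∣ (φ (g zero)) (tabulate (φ ∘ g ∘ suc)) ⟩
  𝟙 (φ (g zero)) + ∣ tabulate (φ ∘ g ∘ suc) ∣
    ≡⟨ cong₂ _+_ (sym (∑ˢ-point (g zero) (𝟙 ∘ φ))) (∣tabulate∣-by-profile (g ∘ suc) φ) ⟩
  ∑ˢ (λ Γ → 𝟙 (does (g zero ≟ Γ)) * 𝟙 (φ Γ)) + ∑ˢ (λ Γ → 𝟙 (φ Γ) * rest Γ)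
    ≡⟨ sym (∑ˢ-+ (λ Γ → 𝟙 (does (g zero ≟ Γ)) * 𝟙 (φ Γ)) (λ Γ → 𝟙 (φ Γ) * rest Γ)) ⟩
  ∑ˢ (λ Γ → 𝟙 (does (g zero ≟ Γ)) * 𝟙 (φ Γ) + 𝟙 (φ Γ) * rest Γ)
    ≡⟨ ∑ˢ-cong (λ Γ → trans (cong (_+ 𝟙 (φ Γ) * rest Γ) (*-comm (𝟙 (does (g zero ≟ Γ))) (𝟙 (φ Γ))))
                            (sym (*-distribˡ-+ (𝟙 (φ Γ)) _ (rest Γ)))) ⟩
  ∑ˢ (λ Γ → 𝟙 (φ Γ) * (𝟙 (does (g zero ≟ Γ)) + rest Γ))
    ≡⟨ ∑ˢ-cong (λ Γ → cong (𝟙 (φ Γ) *_) (sym (∣x∷p∣≡𝟙x+∣p∣ (does (g zero ≟ Γ)) (tabulate (λ x → does (g (suc x) ≟ Γ)))))) ⟩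
  ∑ˢ (λ Γ → 𝟙 (φ Γ) * ∣ tabulate (λ x → does (g x ≟ Γ)) ∣) ∎
  where
  rest : Subset _ → ℕ
  rest Γ = ∣ tabulate (λ x → does (g (suc x) ≟ Γ)) ∣

lookup-⋂-map : ∀ {m n} (F : Fin m → Subset n) (L : List (Fin m)) x →
  lookup (⋂ (List.map F L)) x ≡ all (λ i → lookup (F i) x) L
lookup-⋂-map F List.[]    x = lookup-replicate x true
lookup-⋂-map F (i List.∷ L) x = trans (lookup-zipWith _∧_ x (F i) _) (cong (lookup (F i) x ∧_) (lookup-⋂-map F L x))

lookup-⋃-map : ∀ {m n} (F : Fin m → Subset n) (L : List (Fin m)) x →
  lookup (⋃ (List.map F L)) x ≡ any (λ i → lookup (F i) x) L
lookup-⋃-map F List.[]    x = lookup-replicate x false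
lookup-⋃-map F (i List.∷ L) x = trans (lookup-zipWith _∨_ x (F i) _) (cong (lookup (F i) x ∨_) (lookup-⋃-map F L x))

lookup-─ : ∀ {n} (p q : Subset n) x → lookup (p ─ q) x ≡ lookup p x ∧ not (lookup q x)
lookup-─ (a ∷ p)     (true ∷ q)  zero    = sym (∧-zeroʳ a)
lookup-─ (true ∷ p)  (false ∷ q) zero    = refl
lookup-─ (false ∷ p) (false ∷ q) zero    = refl
lookup-─ (a ∷ p)     (b ∷ q)     (suc x) = lookup-─ p q x

all-filter : ∀ {A : Set} {P : A → Set} (P? : ∀ a → Dec (P a)) (u : A → Bool) (L : List A) →
  all u (filter P? L) ≡ all (λ a → not (does (P? a)) ∨ u a) L
all-filter P? u List.[]    = refl
all-filter P? u (a List.∷ L) with does (P? a)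
... | true  = cong (u a ∧_) (all-filter P? u L)
... | false = all-filter P? u L

any-filter : ∀ {A : Set} {P : A → Set} (P? : ∀ a → Dec (P a)) (u : A → Bool) (L : List A) →
  any u (filter P? L) ≡ any (λ a → does (P? a) ∧ u a) L
any-filter P? u List.[]    = refl
any-filter P? u (a List.∷ L) with does (P? a)
... | true  = cong (u a ∨_) (any-filter P? u L)
... | false = any-filter P? u L

-- In Boolean form: u ⊇ Γ and u ∩ ∁ Γ = ∅ hold together exactly when u = Γ.
⊇∧disjoint-∁≡≟ : ∀ {m} (u : Fin m → Bool) (Γ : Subset m) →
  and (List.tabulate (λ i → not (does (i ∈? Γ)) ∨ u i)) ∧ not (or (List.tabulate (λ i → does (i ∈? ∁ Γ) ∧ u i)))
    ≡ does (tabulate u ≟ Γ)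
⊇∧disjoint-∁≡≟ u []      = refl
⊇∧disjoint-∁≡≟ u (b ∷ Γ) with u zero | b
... | true  | true  = ⊇∧disjoint-∁≡≟ (u ∘ suc) Γ
... | false | true  = refl
... | true  | false = ∧-zeroʳ _
... | false | false = ⊇∧disjoint-∁≡≟ (u ∘ suc) Γ

module _ {m n} (F : Fin m → Subset n) where

  profile : Fin n → Subset m
  profile x = tabulate (λ i → lookup (F i) x)

  region : Subset m → Subset n
  region Γ = ⋂[ F ] Γ ─ ⋃[ F ] ∁ Γ

  lookup-⋂[] : ∀ Γ x → lookup (⋂[ F ] Γ) x ≡ and (List.tabulate (λ i → not (does (i ∈? Γ)) ∨ lookup (F i) x))
  lookup-⋂[] Γ x = trans (lookup-⋂-map F (filter (_∈? Γ) (allFin m)) x)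
    (trans (all-filter (_∈? Γ) u (allFin m)) (cong and (List.map-tabulate (λ i → i) (λ i → not (does (i ∈? Γ)) ∨ u i))))
    where
    u : Fin m → Bool
    u i = lookup (F i) x

  lookup-⋃[] : ∀ Γ x → lookup (⋃[ F ] Γ) x ≡ or (List.tabulate (λ i → does (i ∈? Γ) ∧ lookup (F i) x))
  lookup-⋃[] Γ x = trans (lookup-⋃-map F (filter (_∈? Γ) (allFin m)) x)
    (trans (any-filter (_∈? Γ) u (allFin m)) (cong or (List.map-tabulate (λ i → i) (λ i → does (i ∈? Γ) ∧ u i))))
    where
    u : Fin m → Bool
    u i = lookup (F i) x

  region≡profile⁻¹ : ∀ Γ → region Γ ≡ tabulate (λ x → does (profile x ≟ Γ))
  region≡profile⁻¹ Γ = trans (sym (tabulate∘lookup (region Γ))) (tabulate-cong lookup-region)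
    where
    lookup-region : ∀ x → lookup (region Γ) x ≡ does (profile x ≟ Γ)
    lookup-region x = begin
      lookup (region Γ) x
        ≡⟨ lookup-─ (⋂[ F ] Γ) (⋃[ F ] ∁ Γ) x ⟩
      lookup (⋂[ F ] Γ) x ∧ not (lookup (⋃[ F ] ∁ Γ) x)
        ≡⟨ cong₂ (λ a b → a ∧ not b) (lookup-⋂[] Γ x) (lookup-⋃[] (∁ Γ) x) ⟩
      _ ≡⟨ ⊇∧disjoint-∁≡≟ (λ i → lookup (F i) x) Γ ⟩
      does (profile x ≟ Γ) ∎

  ∣F∣≡∑ˢ-region : ∀ i → ∣ F i ∣ ≡ ∑ˢ (λ Γ → 𝟙 (lookup Γ i) * ∣ region Γ ∣)
  ∣F∣≡∑ˢ-region i = begin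
    ∣ F i ∣
      ≡⟨ cong ∣_∣ (trans (sym (tabulate∘lookup (F i))) (tabulate-cong (λ x → sym (lookup∘tabulate _ i)))) ⟩
    ∣ tabulate (λ x → lookup (profile x) i) ∣
      ≡⟨ ∣tabulate∣-by-profile profile (λ Γ → lookup Γ i) ⟩
    ∑ˢ (λ Γ → 𝟙 (lookup Γ i) * ∣ tabulate (λ x → does (profile x ≟ Γ)) ∣)
      ≡⟨ ∑ˢ-cong (λ Γ → cong (λ R → 𝟙 (lookup Γ i) * ∣ R ∣) (sym (region≡profile⁻¹ Γ))) ⟩
    ∑ˢ (λ Γ → 𝟙 (lookup Γ i) * ∣ region Γ ∣) ∎

mainTheorem9 : ∀ {m n} → .{{_ : NonZero m}} → (F : Fin m → Subset n) →
    Injective _≡_ _≡_ F →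
    (∀ (Γ₁ Γ₂ : Subset m) → Nonempty Γ₁ → Nonempty Γ₂ → Empty (Γ₁ ∩ Γ₂) →
    Γ₁ ∪ Γ₂ ≡ ⊤ →
    ∣ (⋂[ F ] Γ₁) ─ (⋃[ F ] Γ₂) ∣ ≡ ∣ (⋂[ F ] Γ₂) ─ (⋃[ F ] Γ₁) ∣) →
    ∀ (i j : Fin m) → ∣ F i ∣ ≡ ∣ F j ∣
mainTheorem9 F _ balanced i j = begin
  ∣ F i ∣
    ≡⟨ ∣F∣≡∑ˢ-region F i ⟩
  ∑ˢ (λ Γ → 𝟙 (lookup Γ i) * r Γ)
    ≡⟨ ∑ˢ-split (λ Γ → lookup Γ i) (λ Γ → lookup Γ j) r ⟩
  ∑ˢ (λ Γ → 𝟙 (lookup Γ i ∧ lookup Γ j) * r Γ) + ∑ˢ (λ Γ → 𝟙 (lookup Γ i ∧ not (lookup Γ j)) * r Γ)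
    ≡⟨ cong₂ _+_ (∑ˢ-cong (λ Γ → cong (λ b → 𝟙 b * r Γ) (∧-comm (lookup Γ i) (lookup Γ j))))
                 (∑ˢ-separating-swap r r∘∁≗r i j) ⟩
  ∑ˢ (λ Γ → 𝟙 (lookup Γ j ∧ lookup Γ i) * r Γ) + ∑ˢ (λ Γ → 𝟙 (lookup Γ j ∧ not (lookup Γ i)) * r Γ)
    ≡⟨ sym (∑ˢ-split (λ Γ → lookup Γ j) (λ Γ → lookup Γ i) r) ⟩
  ∑ˢ (λ Γ → 𝟙 (lookup Γ j) * r Γ)
    ≡⟨ sym (∣F∣≡∑ˢ-region F j) ⟩
  ∣ F j ∣ ∎
  where
  r : Subset _ → ℕ
  r Γ = ∣ region F Γ ∣

  r∘∁≗r : ∀ Γ → Nonempty Γ → Nonempty (∁ Γ) → r Γ ≡ r (∁ Γ)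
  r∘∁≗r Γ Γ≠∅ ∁Γ≠∅ = trans (balanced Γ (∁ Γ) Γ≠∅ ∁Γ≠∅ (∁-disjoint Γ) (p∪∁p≡⊤ Γ))
    (cong (λ Δ → ∣ ⋂[ F ] ∁ Γ ─ ⋃[ F ] Δ ∣) (sym (∁-involutive Γ)))
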